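{- Let $K\ge1$, $m=2^K-1$, and $\Delta(n)=a_m(n)\oplus a_m(n+1)$ for $n\ge0$. Then for all $n\ge1$, \[ p_{a_m}(n)=2\,p_\Delta(n-1). \]
   Context: For $n\ge0$ write $b_p(n)=\lfloor n/2^p\rfloor\bmod 2$; $\oplus$ is XOR and $\&$ is bitwise AND. For $m\ge0$, $a_m(n)=\bigoplus_{p\ge0,\ p\,\&\,m=0}b_p(n)$, viewed as the infinite word $a_m(0)a_m(1)\cdots$; $\Delta$ is likewise viewed as the infinite word $\Delta(0)\Delta(1)\cdots$. For an infinite word $w$, $p_w(n)$ is the number of distinct factors (contiguous subwords) of $w$ of length $n$ (with $p_w(0)=1$, the empty word). -}

module Defs where

open import Data.Nat using (ℕ; zero; suc; _+_; _*_; _^_; _∸_)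
open import Data.Nat.DivMod using (_/_; _%_)
open import Data.Bool using (Bool; true; false; _xor_; if_then_else_)
open import Data.Fin using (toℕ)
open import Data.Vec using (Vec; tabulate)
open import Data.List using (List; length)
open import Data.List.Relation.Unary.All using (All)
open import Data.List.Relation.Unary.Unique.Propositional using (Unique)
open import Data.List.Membership.Propositional using (_∈_)
open import Data.Product using (Σ; ∃; _×_)
open import Relation.Binary.PropositionalEquality using (_≡_)
open import Relation.Nullary.Decidable using (⌊_⌋)
open import Data.Nat.Properties using (_≟_; m^n≢0)

Word : Set
Word = ℕ → Bool

bit : ℕ → ℕ → Bool
bit p n = ⌊ (_/_ n (2 ^ p) {{m^n≢0 2 p}}) % 2 ≟ 1 ⌋

-- bitwise AND, by recursion on binary digits (fuel argument; fuel p suffices)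
andFuel : ℕ → ℕ → ℕ → ℕ
andFuel zero    p m = 0
andFuel (suc f) p m = (p % 2) * (m % 2) + 2 * andFuel f (p / 2) (m / 2)

_&_ : ℕ → ℕ → ℕ
p & m = andFuel (suc p) p m

xorUpTo : ℕ → ℕ → ℕ → Bool
xorUpTo m n zero = false
xorUpTo m n (suc p) =
  xorUpTo m n p xor (if ⌊ (p & m) ≟ 0 ⌋ then bit p n else false)

-- a_m(n) = XOR_{p ≥ 0, p & m = 0} b_p(n); bits b_p(n) vanish for p ≥ n + 1
-- (since 2^p > n), so the infinite XOR is the XOR over p < n + 1.
a : ℕ → Word
a m n = xorUpTo m n (suc n)

Δ : ℕ → Word
Δ m n = a m n xor a m (suc n)

factor : Word → ℕ → (n : ℕ) → Vec Bool n
factor w i n = tabulate (λ k → w (i + toℕ k))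

-- "p_w(n) = k": there is a duplicate-free list of length k whose elements
-- are exactly the distinct factors of w of length n.
Complexity : Word → ℕ → ℕ → Set
Complexity w n k =
  Σ (List (Vec Bool n)) λ L →
    length L ≡ k × Unique L ×
    All (λ v → ∃ λ i → factor w i n ≡ v) L ×
    (∀ i → factor w i n ∈ L)

-- The p with p & (2^K - 1) = 0 are the multiples of 2^K, and bit p·2^K of n is the parity
-- of the p-th digit of n in base N = 2^2^K.  So a_m(n) is the parity of the base-N digit
-- sum of n, and a_m(r + N^t q) = a_m(r) ⊕ a_m(q) for r < N^t.  Shifting a window by a
-- large power N^t (a_m(1) = 1) complements it, so the factors of a_m are closed under
-- complement.  A factor of length n + 1 is its first letter integrated along its difference
-- factor, a factor of Δ of length n; integration is injective and complement-closure lets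
-- both first letters occur.  Finiteness of the complexities is witnessed constructively:
-- the window of length n + 1 at r + N^n q (r < N^n) depends only on r and
-- (a_m(q), a_m(q+1)), and every such pair occurs below 2N.

module Submission where

open import Defs
open import Data.Bool using (Bool; true; false; not; _xor_; if_then_else_)
open import Data.Bool.Properties as Bool
  using (not-injective; not-distribˡ-xor; xor-assoc; xor-comm; xor-same; xor-identityʳ; ¬-not; if-eta)
open import Data.Fin using (toℕ)
open import Data.Fin.Properties using (toℕ<n)
open import Data.List using (length; map; _++_; upTo; deduplicate)
open import Data.List.Properties using (length-++; length-map)
open import Data.List.Membership.Propositional using (_∈_)
open import Data.List.Membership.Propositional.Properties
  using (∈-map⁺; ∈-map⁻; ∈-++⁺ˡ; ∈-++⁺ʳ; ∈-++⁻; ∈-upTo⁺; ∈-deduplicate⁺; ∈-deduplicate⁻)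
import Data.List.Relation.Unary.All as All
open import Data.List.Relation.Unary.Unique.Propositional using (Unique)
import Data.List.Relation.Unary.Unique.Propositional.Properties as Unique
open import Data.List.Relation.Unary.Unique.DecPropositional.Properties using (deduplicate-!)
open import Data.Nat
open import Data.Nat.Properties
open import Data.Nat.DivMod
open import Algebra.Properties.CommutativeSemigroup +-commutativeSemigroup
  renaming (xy∙z≈xz∙y to +-rightComm)
  using ()
open import Data.Nat.Divisibility using (divides-refl)
open import Data.Nat.Tactic.RingSolver using (solve-∀)
open import Data.Product using (Σ; ∃; _×_; _,_; proj₁; proj₂)
open import Data.Sum using (inj₁; inj₂)
open import Data.Vec as Vec using (Vec; []; _∷_)
open import Data.Vec.Properties using (∷-injective; tabulate-cong; tabulate-∘; ≡-dec)
open import Function using (id; _∘_)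
open import Relation.Binary.PropositionalEquality
open import Relation.Nullary using (yes; no; ¬_)
open import Relation.Nullary.Decidable using (⌊_⌋)

-- Factors, differences and integration

xor-cancelˡ : ∀ b {d d'} → b xor d ≡ b xor d' → d ≡ d'
xor-cancelˡ false = id
xor-cancelˡ true  = not-injective

xor-recoverʳ : ∀ x y → x xor (x xor y) ≡ y
xor-recoverʳ x y = trans (sym (xor-assoc x x y)) (cong (_xor y) (xor-same x))

integrate : ∀ {n} → Bool → Vec Bool n → Vec Bool (suc n)
integrate b []      = b ∷ []
integrate b (d ∷ v) = b ∷ integrate (b xor d) v

integrate-injective : ∀ {n b b'} {v v' : Vec Bool n} →
                      integrate b v ≡ integrate b' v' → b ≡ b' × v ≡ v'
integrate-injective {v = []}    {[]}      refl = refl , refl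
integrate-injective {b = b} {v = d ∷ v} {d' ∷ v'} eq with ∷-injective eq
... | refl , eq′ with integrate-injective eq′
... | b⊕d≡b⊕d' , refl = refl , cong (_∷ v) (xor-cancelˡ b b⊕d≡b⊕d')

integrate-not : ∀ {n} b (v : Vec Bool n) → integrate (not b) v ≡ Vec.map not (integrate b v)
integrate-not b []      = refl
integrate-not b (d ∷ v) = cong (not b ∷_) (begin
  integrate (not b xor d) v   ≡⟨ cong (λ c → integrate c v) (sym (not-distribˡ-xor b d)) ⟩
  integrate (not (b xor d)) v ≡⟨ integrate-not (b xor d) v ⟩
  Vec.map not (integrate (b xor d) v) ∎)
  where open ≡-Reasoning

differenceWord : Word → Word
differenceWord w i = w i xor w (suc i)

factor-cong : ∀ (w w' : Word) i i' n → (∀ k → k < n → w (i + k) ≡ w' (i' + k)) →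
              factor w i n ≡ factor w' i' n
factor-cong w w' i i' n agree = tabulate-cong (λ k → agree (toℕ k) (toℕ<n k))

factor-suc : ∀ (w : Word) i n → factor w i (suc n) ≡ w i ∷ factor w (suc i) n
factor-suc w i n = cong₂ _∷_ (cong w (+-identityʳ i)) (tabulate-cong (λ k → cong w (+-suc i (toℕ k))))

factor-integrate : ∀ (w : Word) i n →
                   factor w i (suc n) ≡ integrate (w i) (factor (differenceWord w) i n)
factor-integrate w i zero    = factor-suc w i 0
factor-integrate w i (suc n) = begin
  factor w i (suc (suc n))                              ≡⟨ factor-suc w i (suc n) ⟩
  w i ∷ factor w (suc i) (suc n)                        ≡⟨ cong (w i ∷_) (factor-integrate w (suc i) n) ⟩
  w i ∷ integrate (w (suc i)) (factor D (suc i) n)      ≡⟨ cong (λ b → w i ∷ integrate b (factor D (suc i) n))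
                                                             (sym (xor-recoverʳ (w i) (w (suc i)))) ⟩
  integrate (w i) (D i ∷ factor D (suc i) n)            ≡⟨ cong (integrate (w i)) (sym (factor-suc D i n)) ⟩
  integrate (w i) (factor D i (suc n))                  ∎
  where
  open ≡-Reasoning
  D = differenceWord w

FactorsOccurBefore : Word → ℕ → ℕ → Set
FactorsOccurBefore w n B = ∀ i → ∃ λ i' → i' < B × factor w i n ≡ factor w i' n

factorsOccurBefore⇒complexity : ∀ {w n B} → FactorsOccurBefore w n B → ∃ (Complexity w n)
factorsOccurBefore⇒complexity {w} {n} {B} occurs =
  length L , L , refl , deduplicate-! _≟ᵥ_ _ , All.tabulate realised , complete
  where
  _≟ᵥ_ = ≡-dec Bool._≟_
  L = deduplicate _≟ᵥ_ (map (λ i → factor w i n) (upTo B))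

  realised : ∀ {v} → v ∈ L → ∃ λ i → factor w i n ≡ v
  realised v∈L with i , _ , v≡ ← ∈-map⁻ (λ i → factor w i n) (∈-deduplicate⁻ _≟ᵥ_ _ v∈L) = i , sym v≡

  complete : ∀ i → factor w i n ∈ L
  complete i with i' , i'<B , eq ← occurs i =
    subst (_∈ L) (sym eq) (∈-deduplicate⁺ _≟ᵥ_ (∈-map⁺ (λ i → factor w i n) (∈-upTo⁺ i'<B)))

differenceWord-factorsOccurBefore : ∀ {w n B} → FactorsOccurBefore w (suc n) B →
                                    FactorsOccurBefore (differenceWord w) n B
differenceWord-factorsOccurBefore {w} {n} occurs i with i' , i'<B , eq ← occurs i =
  i' , i'<B , proj₂ (integrate-injective (begin
    integrate (w i) (factor (differenceWord w) i n)   ≡⟨ sym (factor-integrate w i n) ⟩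
    factor w i (suc n)                                ≡⟨ eq ⟩
    factor w i' (suc n)                               ≡⟨ factor-integrate w i' n ⟩
    integrate (w i') (factor (differenceWord w) i' n) ∎))
  where open ≡-Reasoning

ClosedUnderComplement : Word → ℕ → Set
ClosedUnderComplement w n = ∀ i → ∃ λ j → factor w j n ≡ Vec.map not (factor w i n)

complexity-double : ∀ {w n j} → ClosedUnderComplement w (suc n) →
                    Complexity (differenceWord w) n j → Complexity w (suc n) (2 * j)
complexity-double {w} {n} {j} closed (L , length-L , unique-L , realised-L , complete-L) =
  L₂ , length-L₂ , unique-L₂ , All.tabulate realised-L₂ , complete-L₂
  where
  D = differenceWord w
  L₂ = map (integrate true) L ++ map (integrate false) L

  length-L₂ : length L₂ ≡ 2 * j
  length-L₂ = begin
    length L₂                                                   ≡⟨ length-++ (map (integrate true) L) ⟩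
    length (map (integrate true) L) + length (map (integrate false) L)
      ≡⟨ cong₂ _+_ (length-map (integrate true) L) (length-map (integrate false) L) ⟩
    length L + length L                                         ≡⟨ cong (λ k → k + k) length-L ⟩
    j + j                                                       ≡⟨ cong (j +_) (sym (+-identityʳ j)) ⟩
    2 * j                                                       ∎
    where open ≡-Reasoning

  unique-L₂ : Unique L₂
  unique-L₂ = Unique.++⁺ (Unique.map⁺ (proj₂ ∘ integrate-injective) unique-L)
                         (Unique.map⁺ (proj₂ ∘ integrate-injective) unique-L) disjoint
    where
    disjoint : ∀ {v} → ¬ (v ∈ map (integrate true) L × v ∈ map (integrate false) L)
    disjoint (v∈ᵗ , v∈ᶠ) with _ , _ , refl ← ∈-map⁻ (integrate true) v∈ᵗ
                         with _ , _ , eq ← ∈-map⁻ (integrate false) v∈ᶠ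
                         with () ← proj₁ (integrate-injective eq)

  realise : ∀ b i → ∃ λ j → factor w j (suc n) ≡ integrate b (factor D i n)
  realise b i with b Bool.≟ w i
  ... | yes refl = i , factor-integrate w i n
  ... | no b≢wi with j , eq ← closed i = j , (begin
    factor w j (suc n)                            ≡⟨ eq ⟩
    Vec.map not (factor w i (suc n))              ≡⟨ cong (Vec.map not) (factor-integrate w i n) ⟩
    Vec.map not (integrate (w i) (factor D i n))  ≡⟨ sym (integrate-not (w i) (factor D i n)) ⟩
    integrate (not (w i)) (factor D i n)          ≡⟨ cong (λ c → integrate c (factor D i n)) (sym (¬-not b≢wi)) ⟩
    integrate b (factor D i n)                    ∎)
    where open ≡-Reasoning

  realised-map : ∀ b {v} → v ∈ map (integrate b) L → ∃ λ j → factor w j (suc n) ≡ v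
  realised-map b v∈ with u , u∈L , refl ← ∈-map⁻ (integrate b) v∈
                     with i , refl ← All.lookup realised-L u∈L = realise b i

  realised-L₂ : ∀ {v} → v ∈ L₂ → ∃ λ j → factor w j (suc n) ≡ v
  realised-L₂ v∈ with ∈-++⁻ (map (integrate true) L) v∈
  ... | inj₁ v∈ᵗ = realised-map true v∈ᵗ
  ... | inj₂ v∈ᶠ = realised-map false v∈ᶠ

  complete-L₂ : ∀ i → factor w i (suc n) ∈ L₂
  complete-L₂ i rewrite factor-integrate w i n with w i
  ... | true  = ∈-++⁺ˡ (∈-map⁺ (integrate true) (complete-L i))
  ... | false = ∈-++⁺ʳ (map (integrate true) L) (∈-map⁺ (integrate false) (complete-L i))

-- Powers of two, masks and bits

n<2^n : ∀ n → n < 2 ^ n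
n<2^n zero    = s≤s z≤n
n<2^n (suc n) = begin-strict
  suc n         ≤⟨ n<2^n n ⟩
  2 ^ n         <⟨ m<m+n (2 ^ n) (m^n>0 2 n) ⟩
  2 ^ n + 2 ^ n ≡⟨ cong (2 ^ n +_) (sym (+-identityʳ (2 ^ n))) ⟩
  2 ^ suc n     ∎
  where open ≤-Reasoning

2^-even : ∀ e → 0 < e → ∃ λ h → 2 ^ e ≡ 2 + h * 2
2^-even (suc e) _ with 2 ^ e | m^n>0 2 e
... | suc h | _ = h , trans (*-suc 2 h) (cong (2 +_) (*-comm 2 h))

andFuel-zeroʳ : ∀ f p → andFuel f p 0 ≡ 0
andFuel-zeroʳ zero    p = refl
andFuel-zeroʳ (suc f) p = cong₂ (λ x y → x + 2 * y) (*-zeroʳ (p % 2)) (andFuel-zeroʳ f (p / 2))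

m%[2*n]≡m%2+2*[m/2%n] : ∀ m n .{{_ : NonZero n}} .{{_ : NonZero (2 * n)}} →
                        m % (2 * n) ≡ m % 2 + 2 * (m / 2 % n)
m%[2*n]≡m%2+2*[m/2%n] m n@(suc n-1) = begin
  m % (2 * n)                         ≡⟨ cong (_% (2 * n)) m≡r+q*[2*n] ⟩
  (r + m / 2 / n * (2 * n)) % (2 * n) ≡⟨ [m+kn]%n≡m%n r (m / 2 / n) (2 * n) ⟩
  r % (2 * n)                         ≡⟨ m<n⇒m%n≡m r<2*n ⟩
  r                                   ∎
  where
  open ≡-Reasoning
  r = m % 2 + 2 * (m / 2 % n)

  r<2*n : r < 2 * n
  r<2*n = <-≤-trans (+-mono-<-≤ (m%n<n m 2) (*-monoʳ-≤ 2 (s≤s⁻¹ (m%n<n (m / 2) n))))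
                    (≤-reflexive (sym (*-suc 2 n-1)))

  m≡r+q*[2*n] : m ≡ r + m / 2 / n * (2 * n)
  m≡r+q*[2*n] = begin
    m                                                ≡⟨ m≡m%n+[m/n]*n m 2 ⟩
    m % 2 + m / 2 * 2                                ≡⟨ cong (λ x → m % 2 + x * 2) (m≡m%n+[m/n]*n (m / 2) n) ⟩
    m % 2 + (m / 2 % n + m / 2 / n * n) * 2          ≡⟨ regroup (m % 2) (m / 2 % n) (m / 2 / n) n ⟩
    r + m / 2 / n * (2 * n)                          ∎
    where
    regroup : ∀ x y q n → x + (y + q * n) * 2 ≡ (x + 2 * y) + q * (2 * n)
    regroup = solve-∀

2*n∸1≡1+[n∸1]*2 : ∀ {n} → 0 < n → 2 * n ∸ 1 ≡ 1 + (n ∸ 1) * 2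
2*n∸1≡1+[n∸1]*2 {suc n} _ = trans (+-suc n (n + 0)) (cong suc (*-comm 2 n))

andFuel-mask : ∀ K f p .{{_ : NonZero (2 ^ K)}} → p < 2 ^ f → andFuel f p (2 ^ K ∸ 1) ≡ p % 2 ^ K
andFuel-mask K       zero    zero    _       = sym (m<n⇒m%n≡m (m^n>0 2 K))
andFuel-mask K       zero    (suc p) (s≤s ())
andFuel-mask zero    (suc f) p       _ = trans (andFuel-zeroʳ (suc f) p) (sym (n%1≡0 p))
andFuel-mask (suc K) (suc f) p p<2^f+1 = begin
  andFuel (suc f) p (2 ^ suc K ∸ 1)
    ≡⟨ cong (andFuel (suc f) p) (2*n∸1≡1+[n∸1]*2 (m^n>0 2 K)) ⟩
  p % 2 * ((1 + mask * 2) % 2) + 2 * andFuel f (p / 2) ((1 + mask * 2) / 2)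
    ≡⟨ cong₂ (λ x y → p % 2 * x + 2 * andFuel f (p / 2) y) ([m+kn]%n≡m%n 1 mask 2) [1+mask*2]/2≡mask ⟩
  p % 2 * 1 + 2 * andFuel f (p / 2) mask
    ≡⟨ cong₂ (λ x y → x + 2 * y) (*-identityʳ (p % 2)) (andFuel-mask K f (p / 2) p/2<2^f) ⟩
  p % 2 + 2 * (p / 2 % 2 ^ K)
    ≡⟨ sym (m%[2*n]≡m%2+2*[m/2%n] p (2 ^ K)) ⟩
  p % 2 ^ suc K
    ∎
  where
  open ≡-Reasoning
  mask = 2 ^ K ∸ 1
  instance _ = m^n≢0 2 K

  [1+mask*2]/2≡mask : (1 + mask * 2) / 2 ≡ mask
  [1+mask*2]/2≡mask = trans (+-distrib-/-∣ʳ 1 {d = 2} (divides-refl mask)) (m*n/n≡m mask 2)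

  p/2<2^f : p / 2 < 2 ^ f
  p/2<2^f = m<n*o⇒m/o<n (subst (p <_) (*-comm 2 (2 ^ f)) p<2^f+1)

&-mask : ∀ K p .{{_ : NonZero (2 ^ K)}} → p & (2 ^ K ∸ 1) ≡ p % 2 ^ K
&-mask K p = andFuel-mask K (suc p) p (<-trans (n<1+n p) (n<2^n (suc p)))

bit-≥ : ∀ p {n} → n < 2 ^ p → bit p n ≡ false
bit-≥ p n<2^p = cong (λ x → ⌊ x % 2 ≟ 1 ⌋) (m<n⇒m/n≡0 {{m^n≢0 2 p}} n<2^p)

bit-+ : ∀ p q n .{{_ : NonZero (2 ^ q)}} → bit (p + q) n ≡ bit p (n / 2 ^ q)
bit-+ p q n = cong (λ x → ⌊ x % 2 ≟ 1 ⌋) (begin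
  n / 2 ^ (p + q)       ≡⟨ /-congʳ (trans (cong (2 ^_) (+-comm p q)) (^-distribˡ-+-* 2 q p)) ⟩
  n / (2 ^ q * 2 ^ p)   ≡⟨ sym (m/n/o≡m/[n*o] n (2 ^ q) (2 ^ p)) ⟩
  n / 2 ^ q / 2 ^ p     ∎)
  where
  open ≡-Reasoning
  instance
    _ = m^n≢0 2 p
    _ = m^n≢0 2 (p + q)
    _ = m*n≢0 (2 ^ q) (2 ^ p)

bit0-+*2 : ∀ r k → bit 0 (r + k * 2) ≡ bit 0 r
bit0-+*2 r k = cong (λ x → ⌊ x ≟ 1 ⌋) (begin
  (r + k * 2) / 1 % 2   ≡⟨ cong (_% 2) (n/1≡n (r + k * 2)) ⟩
  (r + k * 2) % 2       ≡⟨ [m+kn]%n≡m%n r k 2 ⟩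
  r % 2                 ≡⟨ cong (_% 2) (sym (n/1≡n r)) ⟩
  r / 1 % 2             ∎)
  where open ≡-Reasoning

summand : ℕ → ℕ → ℕ → Bool
summand m n p = if ⌊ p & m ≟ 0 ⌋ then bit p n else false

summand-≥ : ∀ m {n} p → n < 2 ^ p → summand m n p ≡ false
summand-≥ m p n<2^p =
  trans (cong (λ b → if ⌊ p & m ≟ 0 ⌋ then b else false) (bit-≥ p n<2^p)) (if-eta ⌊ p & m ≟ 0 ⌋)

xorUpTo-+-suc : ∀ m n d → xorUpTo m n (d + suc n) ≡ a m n
xorUpTo-+-suc m n zero    = refl
xorUpTo-+-suc m n (suc d) = begin
  xorUpTo m n (d + suc n) xor summand m n (d + suc n)
    ≡⟨ cong (xorUpTo m n (d + suc n) xor_)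
            (summand-≥ m (d + suc n) (<-trans (m≤n+m (suc n) d) (n<2^n (d + suc n)))) ⟩
  xorUpTo m n (d + suc n) xor false
    ≡⟨ xor-identityʳ _ ⟩
  xorUpTo m n (d + suc n)
    ≡⟨ xorUpTo-+-suc m n d ⟩
  a m n
    ∎
  where open ≡-Reasoning

-- The word a_(2^K - 1)

module GeneralisedThueMorse (K : ℕ) where

  M N mask : ℕ
  M    = 2 ^ K
  N    = 2 ^ M
  mask = 2 ^ K ∸ 1

  instance
    M-nonZero : NonZero M
    M-nonZero = m^n≢0 2 K
    N-nonZero : NonZero N
    N-nonZero = m^n≢0 2 M

  A : Word
  A = a mask

  summand-between : ∀ n {p} → 0 < p → p < M → summand mask n p ≡ false
  summand-between n {suc p} _ p<M = cong (λ x → if ⌊ x ≟ 0 ⌋ then bit (suc p) n else false)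
                                         (trans (&-mask K (suc p)) (m<n⇒m%n≡m p<M))

  summand-+M : ∀ n p → summand mask n (p + M) ≡ summand mask (n / N) p
  summand-+M n p = cong₂ (λ x b → if ⌊ x ≟ 0 ⌋ then b else false) (begin
    (p + M) & mask ≡⟨ &-mask K (p + M) ⟩
    (p + M) % M    ≡⟨ [m+n]%n≡m%n p M ⟩
    p % M          ≡⟨ sym (&-mask K p) ⟩
    p & mask       ∎) (bit-+ p M n)
    where open ≡-Reasoning

  xorUpTo-≤M : ∀ n p → 0 < p → p ≤ M → xorUpTo mask n p ≡ bit 0 n
  xorUpTo-≤M n 1             _ _   = refl
  xorUpTo-≤M n (suc (suc p)) _ p<M = begin
    xorUpTo mask n (suc p) xor summand mask n (suc p)
      ≡⟨ cong (xorUpTo mask n (suc p) xor_) (summand-between n (s≤s z≤n) p<M) ⟩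
    xorUpTo mask n (suc p) xor false
      ≡⟨ xor-identityʳ _ ⟩
    xorUpTo mask n (suc p)
      ≡⟨ xorUpTo-≤M n (suc p) (s≤s z≤n) (<⇒≤ p<M) ⟩
    bit 0 n
      ∎
    where open ≡-Reasoning

  xorUpTo-+M : ∀ n B → xorUpTo mask n (B + M) ≡ bit 0 n xor xorUpTo mask (n / N) B
  xorUpTo-+M n zero    = trans (xorUpTo-≤M n M (m^n>0 2 K) ≤-refl) (sym (xor-identityʳ _))
  xorUpTo-+M n (suc B) = begin
    xorUpTo mask n (B + M) xor summand mask n (B + M)
      ≡⟨ cong₂ _xor_ (xorUpTo-+M n B) (summand-+M n B) ⟩
    (bit 0 n xor xorUpTo mask (n / N) B) xor summand mask (n / N) B
      ≡⟨ xor-assoc (bit 0 n) _ _ ⟩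
    bit 0 n xor xorUpTo mask (n / N) (suc B)
      ∎
    where open ≡-Reasoning

  a-split-lowDigit : ∀ n → A n ≡ bit 0 n xor A (n / N)
  a-split-lowDigit n = begin
    A n                                            ≡⟨ sym (xorUpTo-+-suc mask n M) ⟩
    xorUpTo mask n (M + suc n)                     ≡⟨ cong (xorUpTo mask n) (+-comm M (suc n)) ⟩
    xorUpTo mask n (suc n + M)                     ≡⟨ xorUpTo-+M n (suc n) ⟩
    bit 0 n xor xorUpTo mask (n / N) (suc n)       ≡⟨ cong (λ B → bit 0 n xor xorUpTo mask (n / N) B)
                                                           (sym (m∸n+n≡m (s≤s (m/n≤m n N)))) ⟩
    bit 0 n xor xorUpTo mask (n / N) (n ∸ n / N + suc (n / N))
                                                   ≡⟨ cong (bit 0 n xor_) (xorUpTo-+-suc mask (n / N) (n ∸ n / N)) ⟩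
    bit 0 n xor A (n / N)                          ∎
    where open ≡-Reasoning

  bit0-+*N : ∀ r y → bit 0 (r + y * N) ≡ bit 0 r
  bit0-+*N r y with h , N≡[1+h]*2 ← 2^-even M (m^n>0 2 K) =
    trans (cong (λ z → bit 0 (r + y * z)) N≡[1+h]*2)
          (trans (cong (λ z → bit 0 (r + z)) (sym (*-assoc y (suc h) 2))) (bit0-+*2 r (y * suc h)))

  a-additive : ∀ t q {r} → r < N ^ t → A (r + N ^ t * q) ≡ A r xor A q
  a-additive zero    q {zero}  _         = cong A (+-identityʳ q)
  a-additive zero    q {suc r} (s≤s ())
  a-additive (suc t) q {r} r<N^[1+t] = begin
    A (r + N ^ suc t * q)                         ≡⟨ cong (λ z → A (r + z))
                                                         (trans (*-assoc N (N ^ t) q) (*-comm N (N ^ t * q))) ⟩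
    A (r + N ^ t * q * N)                         ≡⟨ a-split-lowDigit (r + N ^ t * q * N) ⟩
    bit 0 (r + N ^ t * q * N) xor A ((r + N ^ t * q * N) / N)
                                                  ≡⟨ cong₂ _xor_ (bit0-+*N r (N ^ t * q)) (cong A [r+x*N]/N≡r/N+x) ⟩
    bit 0 r xor A (r / N + N ^ t * q)             ≡⟨ cong (bit 0 r xor_) (a-additive t q r/N<N^t) ⟩
    bit 0 r xor (A (r / N) xor A q)               ≡⟨ sym (xor-assoc (bit 0 r) _ _) ⟩
    (bit 0 r xor A (r / N)) xor A q               ≡⟨ cong (_xor A q) (sym (a-split-lowDigit r)) ⟩
    A r xor A q                                   ∎
    where
    open ≡-Reasoning
    [r+x*N]/N≡r/N+x : (r + N ^ t * q * N) / N ≡ r / N + N ^ t * q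
    [r+x*N]/N≡r/N+x = trans (+-distrib-/-∣ʳ r (divides-refl (N ^ t * q)))
                            (cong (r / N +_) (m*n/n≡m (N ^ t * q) N))
    r/N<N^t : r / N < N ^ t
    r/N<N^t = m<n*o⇒m/o<n (subst (r <_) (*-comm N (N ^ t)) r<N^[1+t])

  a-additive-N : ∀ q {r} → r < N → A (r + N * q) ≡ A r xor A q
  a-additive-N q {r} r<N = trans (cong (λ z → A (r + z * q)) (sym (*-identityʳ N)))
                                 (a-additive 1 q (subst (r <_) (sym (*-identityʳ N)) r<N))

  a-N* : ∀ q → A (N * q) ≡ A q
  a-N* q = a-additive-N q (m^n>0 2 M)

  a-below-N : ∀ {r} → r < N → A r ≡ bit 0 r
  a-below-N {r} r<N = trans (a-split-lowDigit r)
                            (trans (cong (λ z → bit 0 r xor A z) (m<n⇒m/n≡0 r<N)) (xor-identityʳ _))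

  1<N : 1 < N
  1<N = ^-monoʳ-< 2 (s≤s (s≤s z≤n)) (m^n>0 2 K)

  n<N^n : ∀ n → n < N ^ n
  n<N^n n = <-≤-trans (n<2^n n) (^-monoˡ-≤ n 1<N)

  a-1 : A 1 ≡ true
  a-1 = a-below-N 1<N

  -- The only use of K ≥ 1: for K = 0 (the Thue–Morse word) A 2 = true.
  a-2 : 1 ≤ K → A 2 ≡ false
  a-2 K≥1 = a-below-N (^-monoʳ-< 2 (s≤s (s≤s z≤n)) (^-monoʳ-< 2 (s≤s (s≤s z≤n)) K≥1))

  a-N∸1 : ∃ λ o → suc o ≡ N × A o ≡ true
  a-N∸1 with h , N≡2+h*2 ← 2^-even M (m^n>0 2 K) =
    1 + h * 2 , sym N≡2+h*2 , trans (a-below-N (≤-reflexive (sym N≡2+h*2))) (bit0-+*2 1 h)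

  a-consecutive-values : 1 ≤ K → ∀ x y → ∃ λ c → c < N + N × A c ≡ x × A (suc c) ≡ y
  a-consecutive-values K≥1 false true  = 0 , ≤-trans (m^n>0 2 M) (m≤m+n N N) , refl , a-1
  a-consecutive-values K≥1 true  false = 1 , <-≤-trans 1<N (m≤m+n N N) , a-1 , a-2 K≥1
  a-consecutive-values K≥1 true  true  with o , 1+o≡N , a-o ← a-N∸1 =
    o , ≤-trans (≤-reflexive 1+o≡N) (m≤m+n N N) , a-o , (begin
      A (suc o) ≡⟨ cong A (trans 1+o≡N (sym (*-identityʳ N))) ⟩
      A (N * 1) ≡⟨ a-N* 1 ⟩
      A 1       ≡⟨ a-1 ⟩
      true      ∎)
    where open ≡-Reasoning
  a-consecutive-values K≥1 false false with o , 1+o≡N , a-o ← a-N∸1 =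
    o + N * 1 , ≤-reflexive 2+o+N≡N+N , (begin
      A (o + N * 1)    ≡⟨ a-additive-N 1 (≤-reflexive 1+o≡N) ⟩
      A o xor A 1      ≡⟨ cong₂ _xor_ a-o a-1 ⟩
      false            ∎) , (begin
      A (suc o + N * 1) ≡⟨ cong A (trans (cong (_+ N * 1) 1+o≡N) (sym (*-suc N 1))) ⟩
      A (N * 2)         ≡⟨ a-N* 2 ⟩
      A 2               ≡⟨ a-2 K≥1 ⟩
      false             ∎)
    where
    open ≡-Reasoning
    2+o+N≡N+N : suc (o + N * 1) ≡ N + N
    2+o+N≡N+N = cong₂ _+_ 1+o≡N (*-identityʳ N)

  a-window : ∀ t {q c} → A q ≡ A c → A (suc q) ≡ A (suc c) →
             ∀ s → s < N ^ t + N ^ t → A (s + N ^ t * q) ≡ A (s + N ^ t * c)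
  a-window t {q} {c} a-q≡a-c a-1+q≡a-1+c s s<L+L with s <? N ^ t
  ... | yes s<L = begin
    A (s + L * q) ≡⟨ a-additive t q s<L ⟩
    A s xor A q   ≡⟨ cong (A s xor_) a-q≡a-c ⟩
    A s xor A c   ≡⟨ sym (a-additive t c s<L) ⟩
    A (s + L * c) ∎
    where
    open ≡-Reasoning
    L = N ^ t
  ... | no s≮L with s' , refl ← m≤n⇒∃[o]m+o≡n (≮⇒≥ s≮L) = begin
    A (L + s' + L * q)    ≡⟨ cong A (carry q) ⟩
    A (s' + L * suc q)    ≡⟨ a-additive t (suc q) s'<L ⟩
    A s' xor A (suc q)    ≡⟨ cong (A s' xor_) a-1+q≡a-1+c ⟩
    A s' xor A (suc c)    ≡⟨ sym (a-additive t (suc c) s'<L) ⟩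
    A (s' + L * suc c)    ≡⟨ cong A (sym (carry c)) ⟩
    A (L + s' + L * c)    ∎
    where
    open ≡-Reasoning
    L = N ^ t
    s'<L : s' < L
    s'<L = +-cancelˡ-< L s' L s<L+L
    carry : ∀ x → L + s' + L * x ≡ s' + L * suc x
    carry x = begin
      L + s' + L * x   ≡⟨ cong (_+ L * x) (+-comm L s') ⟩
      s' + L + L * x   ≡⟨ +-assoc s' L (L * x) ⟩
      s' + (L + L * x) ≡⟨ cong (s' +_) (sym (*-suc L x)) ⟩
      s' + L * suc x   ∎

  a-factor-window : ∀ n {q c} → A q ≡ A c → A (suc q) ≡ A (suc c) → ∀ {r} → r < N ^ n →
                    factor A (r + N ^ n * q) (suc n) ≡ factor A (r + N ^ n * c) (suc n)
  a-factor-window n {q} {c} a-q≡a-c a-1+q≡a-1+c {r} r<L =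
    factor-cong A A (r + L * q) (r + L * c) (suc n) agree
    where
    L = N ^ n
    agree : ∀ k → k < suc n → A (r + L * q + k) ≡ A (r + L * c + k)
    agree k k<1+n = begin
      A (r + L * q + k)   ≡⟨ cong A (+-rightComm r (L * q) k) ⟩
      A (r + k + L * q)   ≡⟨ a-window n a-q≡a-c a-1+q≡a-1+c (r + k)
                               (+-mono-<-≤ r<L (≤-trans (s≤s⁻¹ k<1+n) (<⇒≤ (n<N^n n)))) ⟩
      A (r + k + L * c)   ≡⟨ cong A (+-rightComm r k (L * c)) ⟩
      A (r + L * c + k)   ∎
      where open ≡-Reasoning

  a-factorsOccurBefore : 1 ≤ K → ∀ n → FactorsOccurBefore A (suc n) (N ^ n + N ^ n * (N + N))
  a-factorsOccurBefore K≥1 n i =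
    let c , c<N+N , a-c≡a-q , a-1+c≡a-1+q = a-consecutive-values K≥1 (A q) (A (suc q))
    in  r + L * c , +-mono-<-≤ r<L (*-monoʳ-≤ L (<⇒≤ c<N+N)) ,
        trans (cong (λ x → factor A x (suc n)) i≡r+L*q)
              (a-factor-window n (sym a-c≡a-q) (sym a-1+c≡a-1+q) r<L)
    where
    L = N ^ n
    instance _ = m^n≢0 N n
    q = i / L
    r = i % L
    r<L : r < L
    r<L = m%n<n i L
    i≡r+L*q : i ≡ r + L * q
    i≡r+L*q = trans (m≡m%n+[m/n]*n i L) (cong (r +_) (*-comm q L))

  a-closedUnderComplement : ∀ n → ClosedUnderComplement A n
  a-closedUnderComplement n i =
    i + L , trans (factor-cong A (not ∘ A) (i + L) i n agree) (tabulate-∘ not (λ k → A (i + toℕ k)))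
    where
    L = N ^ (i + n)
    agree : ∀ k → k < n → A (i + L + k) ≡ not (A (i + k))
    agree k k<n = begin
      A (i + L + k)         ≡⟨ cong A (trans (+-rightComm i L k) (cong (i + k +_) (sym (*-identityʳ L)))) ⟩
      A (i + k + L * 1)     ≡⟨ a-additive (i + n) 1 (<-trans (+-monoʳ-< i k<n) (n<N^n (i + n))) ⟩
      A (i + k) xor A 1     ≡⟨ cong (A (i + k) xor_) a-1 ⟩
      A (i + k) xor true    ≡⟨ xor-comm (A (i + k)) true ⟩
      not (A (i + k))       ∎
      where open ≡-Reasoning

lemma46 : (K : ℕ) → K ≥ 1 → (n : ℕ) → n ≥ 1 →
    Σ ℕ λ j → Complexity (Δ (2 ^ K ∸ 1)) (n ∸ 1) j × Complexity (a (2 ^ K ∸ 1)) n (2 * j)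
lemma46 K K≥1 (suc n) _ =
  let open GeneralisedThueMorse K
      j , Δ-complexity = factorsOccurBefore⇒complexity {differenceWord A}
                           (differenceWord-factorsOccurBefore {A} (a-factorsOccurBefore K≥1 n))
  in  j , Δ-complexity , complexity-double {A} (a-closedUnderComplement (suc n)) Δ-complexity
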